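{- Let $\mathbf M$ be a cyclic pointed residuated $\mathbf S$-bimodule with point $0$. The map $e_S:S\to S\times M$, $e_S(a)=\langle a,a*0\rangle$ $(=\langle a,0*a\rangle)$, is an isomorphism of posemigroups from $\mathbf S$ onto the image $\sigma[S\times M]$ of $\sigma\langle a,x\rangle=\langle a,a*0\rangle$ (a subposemigroup of $\mathbf S\ltimes\mathbf M$). In particular, as a map into $\mathbf S\ltimes\mathbf M$ (equivalently into $(\mathbf S\ltimes\mathbf M)_0$) it preserves products and all existing joins.
   Context: A posemigroup is a poset with an isotone associative multiplication. $\mathbf S$ is a posemigroup, $\mathbf M=\langle M,\vee\rangle$ a join semilattice; elements of $S$ are $a,b$, of $M$ are $x,y$. A residuated $\mathbf S$-bimodule: isotone actions $a*x,x*a\in M$ with $(ab)*x=a*(b*x)$, $x*(ab)=(x*a)*b$, $(a*x)*b=a*(x*b)$, distributing over $\vee$, and maps $\backslash_\ell,/_\ell,\backslash_r,/_r$ with $x\le a\backslash_\ell y\iff a*x\le y\iff a\le y/_\ell x$ and $x\le y/_r a\iff x*a\le y\iff a\le x\backslash_r y$. Cyclic pointed: $0\in M$ with $a*0=0*a$ for all $a$. The Nagata product $\mathbf S\ltimes\mathbf M$: $S\times M$ with componentwise order and $\langle a,x\rangle\circ\langle b,y\rangle=\langle ab,x*b\vee a*y\rangle$; the restricted Nagata product $(\mathbf S\ltimes\mathbf M)_0$ is its subposemigroup on $\{\langle a,x\rangle:0*a\le x,a*0\le x\}$. -}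

module Defs where

open import Level using (Level; _⊔_; suc)
open import Data.Product using (Σ; Σ-syntax; ∃; ∃-syntax; _×_; _,_; proj₁; proj₂)
open import Relation.Binary.PropositionalEquality using (_≡_)
open import Relation.Unary using (Pred)

record Posemigroup (c ℓ : Level) : Set (suc (c ⊔ ℓ)) where
  infixl 7 _·_
  infix 4 _≤_
  field
    Carrier  : Set c
    _≤_      : Carrier → Carrier → Set ℓ
    ≤-refl   : ∀ {a} → a ≤ a
    ≤-trans  : ∀ {a b c} → a ≤ b → b ≤ c → a ≤ c
    ≤-antisym : ∀ {a b} → a ≤ b → b ≤ a → a ≡ b
    _·_      : Carrier → Carrier → Carrier
    ·-assoc  : ∀ a b c → (a · b) · c ≡ a · (b · c)
    ·-mono   : ∀ {a a' b b'} → a ≤ a' → b ≤ b' → a · b ≤ a' · b'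

record JoinSemilattice (m : Level) : Set (suc m) where
  infixr 6 _∨_
  field
    Carrier : Set m
    _∨_     : Carrier → Carrier → Carrier
    ∨-assoc : ∀ x y z → (x ∨ y) ∨ z ≡ x ∨ (y ∨ z)
    ∨-comm  : ∀ x y → x ∨ y ≡ y ∨ x
    ∨-idem  : ∀ x → x ∨ x ≡ x
  infix 4 _≤_
  _≤_ : Carrier → Carrier → Set m
  x ≤ y = x ∨ y ≡ y

record ResBimodule {c ℓ m : Level} (S : Posemigroup c ℓ) (M : JoinSemilattice m)
       : Set (c ⊔ ℓ ⊔ m) where
  private
    module S = Posemigroup S
    module M = JoinSemilattice M
  field
    _*ₗ_ : S.Carrier → M.Carrier → M.Carrier
    _*ᵣ_ : M.Carrier → S.Carrier → M.Carrier
    *ₗ-mono : ∀ {a b x y} → a S.≤ b → x M.≤ y → (a *ₗ x) M.≤ (b *ₗ y)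
    *ᵣ-mono : ∀ {a b x y} → a S.≤ b → x M.≤ y → (x *ᵣ a) M.≤ (y *ᵣ b)
    *ₗ-assoc : ∀ a b x → (a S.· b) *ₗ x ≡ a *ₗ (b *ₗ x)
    *ᵣ-assoc : ∀ x a b → x *ᵣ (a S.· b) ≡ (x *ᵣ a) *ᵣ b
    *-bimod  : ∀ a x b → (a *ₗ x) *ᵣ b ≡ a *ₗ (x *ᵣ b)
    *ₗ-distrib : ∀ a x y → a *ₗ (x M.∨ y) ≡ (a *ₗ x) M.∨ (a *ₗ y)
    *ᵣ-distrib : ∀ x y a → (x M.∨ y) *ᵣ a ≡ (x *ᵣ a) M.∨ (y *ᵣ a)
    _⧵ₗ_ : S.Carrier → M.Carrier → M.Carrier
    _/ₗ_ : M.Carrier → M.Carrier → S.Carrier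
    _⧵ᵣ_ : M.Carrier → M.Carrier → S.Carrier
    _/ᵣ_ : M.Carrier → S.Carrier → M.Carrier
    resₗ₁ : ∀ {a x y} → (x M.≤ (a ⧵ₗ y) → (a *ₗ x) M.≤ y) × ((a *ₗ x) M.≤ y → x M.≤ (a ⧵ₗ y))
    resₗ₂ : ∀ {a x y} → (a S.≤ (y /ₗ x) → (a *ₗ x) M.≤ y) × ((a *ₗ x) M.≤ y → a S.≤ (y /ₗ x))
    resᵣ₁ : ∀ {a x y} → (x M.≤ (y /ᵣ a) → (x *ᵣ a) M.≤ y) × ((x *ᵣ a) M.≤ y → x M.≤ (y /ᵣ a))
    resᵣ₂ : ∀ {a x y} → (a S.≤ (x ⧵ᵣ y) → (x *ᵣ a) M.≤ y) × ((x *ᵣ a) M.≤ y → a S.≤ (x ⧵ᵣ y))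

record CyclicPointed {c ℓ m : Level} (S : Posemigroup c ℓ) (M : JoinSemilattice m)
       : Set (c ⊔ ℓ ⊔ m) where
  field
    bimodule : ResBimodule S M
    point    : JoinSemilattice.Carrier M
  open ResBimodule bimodule public
  field
    cyclic : ∀ a → a *ₗ point ≡ point *ᵣ a

module _ {a ℓ : Level} {A : Set a} (_≤_ : A → A → Set ℓ) where
  IsUpperBound : {p : Level} → Pred A p → A → Set (a ⊔ ℓ ⊔ p)
  IsUpperBound P u = ∀ x → P x → x ≤ u

  IsJoin : {p : Level} → Pred A p → A → Set (a ⊔ ℓ ⊔ p)
  IsJoin P j = IsUpperBound P j × (∀ u → IsUpperBound P u → j ≤ u)

module Nagata {c ℓ m : Level} {S : Posemigroup c ℓ} {M : JoinSemilattice m}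
              (B : CyclicPointed S M) where
  private
    module S = Posemigroup S
    module M = JoinSemilattice M
  open CyclicPointed B

  Car : Set (c ⊔ m)
  Car = S.Carrier × M.Carrier

  _⊑_ : Car → Car → Set (ℓ ⊔ m)
  (a , x) ⊑ (b , y) = (a S.≤ b) × (x M.≤ y)

  _∘_ : Car → Car → Car
  (a , x) ∘ (b , y) = (a S.· b , (x *ᵣ b) M.∨ (a *ₗ y))

  -- carrier of the restricted Nagata product (S ⋉ M)₀
  InRestricted : Car → Set m
  InRestricted (a , x) = ((point *ᵣ a) M.≤ x) × ((a *ₗ point) M.≤ x)

  Car₀ : Set (c ⊔ m)
  Car₀ = Σ Car InRestricted

  _⊑₀_ : Car₀ → Car₀ → Set (ℓ ⊔ m)
  p ⊑₀ q = proj₁ p ⊑ proj₁ q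

  σ : Car → Car
  σ (a , x) = (a , a *ₗ point)

  eS : S.Carrier → Car
  eS a = (a , a *ₗ point)

  eImage : {p : Level} → Pred S.Carrier p → Pred Car (c ⊔ m ⊔ p)
  eImage A q = ∃[ a ] (A a × q ≡ eS a)

  eImage₀ : {p : Level} → Pred S.Carrier p → Pred Car₀ (c ⊔ m ⊔ p)
  eImage₀ A q = eImage A (proj₁ q)

-- The second component of e_S a is a * 0, and a ↦ a * 0 is residuated (its
-- upper adjoint is y ↦ y /ₗ 0), so it preserves every existing join; the first
-- component is the identity, so e_S preserves joins and is an order embedding.
-- For products, cyclicity a * 0 = 0 * a turns both joinands of the second
-- component of e_S a ∘ e_S b, namely (a * 0) * b and a * (b * 0), into ab * 0.
module Submission where

open import Defs
open import Level using (Level)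
open import Data.Product using (∃-syntax; _×_; _,_; proj₁; proj₂)
open import Relation.Binary.PropositionalEquality using (_≡_; refl; cong; sym; subst; module ≡-Reasoning)
open import Relation.Unary using (Pred)

module ResBimoduleProperties {c ℓ m : Level} {S : Posemigroup c ℓ} {M : JoinSemilattice m}
                             (B : ResBimodule S M) where
  open Posemigroup S
  private module M = JoinSemilattice M
  open ResBimodule B

  *ₗ-monoˡ : ∀ {a b} x → a ≤ b → a *ₗ x M.≤ b *ₗ x
  *ₗ-monoˡ x a≤b = *ₗ-mono a≤b (M.∨-idem x)

  *ₗ-lub : ∀ {p} {A : Pred Carrier p} {j} x {y} → IsJoin _≤_ A j →
           (∀ a → A a → a *ₗ x M.≤ y) → j *ₗ x M.≤ y
  *ₗ-lub x {y} (_ , least) bound =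
    proj₁ resₗ₂ (least (y /ₗ x) (λ a a∈A → proj₂ resₗ₂ (bound a a∈A)))

module EmbeddingProperties {c ℓ m : Level} {S : Posemigroup c ℓ} {M : JoinSemilattice m}
                           (B : CyclicPointed S M) where
  open Posemigroup S
  open Nagata B
  private module M = JoinSemilattice M
  open CyclicPointed B
  open ResBimoduleProperties bimodule

  eS≡⟨a,0*a⟩ : ∀ a → eS a ≡ (a , point *ᵣ a)
  eS≡⟨a,0*a⟩ a = cong (a ,_) (cyclic a)

  eS-restricted : ∀ a → InRestricted (eS a)
  eS-restricted a = subst (λ z → z M.∨ a *ₗ point ≡ a *ₗ point) (cyclic a) (M.∨-idem _)
                  , M.∨-idem _

  eS-image⇔σ-image : ∀ q → (∃[ a ] q ≡ eS a → ∃[ p ] q ≡ σ p) × (∃[ p ] q ≡ σ p → ∃[ a ] q ≡ eS a)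
  eS-image⇔σ-image q = (λ (a , q≡eSa) → (a , point) , q≡eSa)
                     , (λ ((a , _) , q≡σp) → a , q≡σp)

  eS-injective : ∀ a b → eS a ≡ eS b → a ≡ b
  eS-injective a b = cong proj₁

  eS-mono : ∀ {a b} → a ≤ b → eS a ⊑ eS b
  eS-mono a≤b = a≤b , *ₗ-monoˡ point a≤b

  eS-orderEmbedding : ∀ a b → (a ≤ b → eS a ⊑ eS b) × (eS a ⊑ eS b → a ≤ b)
  eS-orderEmbedding a b = eS-mono , proj₁

  ·-*ₗ-point : ∀ a b → (a · b) *ₗ point ≡ (a *ₗ point) *ᵣ b M.∨ a *ₗ (b *ₗ point)
  ·-*ₗ-point a b = begin
    (a · b) *ₗ point                               ≡⟨ sym (M.∨-idem _) ⟩
    (a · b) *ₗ point M.∨ (a · b) *ₗ point          ≡⟨ cong (M._∨ (a · b) *ₗ point) ab0≡a0b ⟩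
    (a *ₗ point) *ᵣ b M.∨ (a · b) *ₗ point         ≡⟨ cong ((a *ₗ point) *ᵣ b M.∨_) (*ₗ-assoc a b point) ⟩
    (a *ₗ point) *ᵣ b M.∨ a *ₗ (b *ₗ point)        ∎
    where
    open ≡-Reasoning
    ab0≡a0b : (a · b) *ₗ point ≡ (a *ₗ point) *ᵣ b
    ab0≡a0b = begin
      (a · b) *ₗ point     ≡⟨ *ₗ-assoc a b point ⟩
      a *ₗ (b *ₗ point)    ≡⟨ cong (a *ₗ_) (cyclic b) ⟩
      a *ₗ (point *ᵣ b)    ≡⟨ sym (*-bimod a point b) ⟩
      (a *ₗ point) *ᵣ b    ∎

  eS-homomorphism : ∀ a b → eS (a · b) ≡ eS a ∘ eS b
  eS-homomorphism a b = cong (a · b ,_) (·-*ₗ-point a b)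

  eS-preservesJoin : ∀ {p} {A : Pred Carrier p} {j} → IsJoin _≤_ A j → IsJoin _⊑_ (eImage A) (eS j)
  eS-preservesJoin {A = A} {j} J@(upper , least) = isUpper , isLeast
    where
    isUpper : IsUpperBound _⊑_ (eImage A) (eS j)
    isUpper _ (a , a∈A , refl) = eS-mono (upper a a∈A)

    isLeast : ∀ u → IsUpperBound _⊑_ (eImage A) u → eS j ⊑ u
    isLeast (b , y) bound =
      least b (λ a a∈A → proj₁ (bound (eS a) (a , a∈A , refl))) ,
      *ₗ-lub point J (λ a a∈A → proj₂ (bound (eS a) (a , a∈A , refl)))

  -- Every e_S a lies in (S ⋉ M)₀, so upper bounds in (S ⋉ M)₀ are upper bounds in S ⋉ M.
  eS-preservesJoin₀ : ∀ {p} {A : Pred Carrier p} {j} → IsJoin _≤_ A j →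
                      (r : InRestricted (eS j)) → IsJoin _⊑₀_ (eImage₀ A) (eS j , r)
  eS-preservesJoin₀ {A = A} {j} J r = isUpper₀ , isLeast₀
    where
    isUpper₀ : IsUpperBound _⊑₀_ (eImage₀ A) (eS j , r)
    isUpper₀ (q , _) = proj₁ (eS-preservesJoin J) q

    isLeast₀ : ∀ u → IsUpperBound _⊑₀_ (eImage₀ A) u → (eS j , r) ⊑₀ u
    isLeast₀ (u , _) bound = proj₂ (eS-preservesJoin J) u
      (λ { _ (a , a∈A , refl) → bound (eS a , eS-restricted a) (a , a∈A , refl) })

mainTheorem7 : {c ℓ m p : Level} (S : Posemigroup c ℓ) (M : JoinSemilattice m)
    (B : CyclicPointed S M) →
    let open Posemigroup S
        open Nagata B
    in
    -- e_S a = ⟨a, 0 * a⟩ as well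
    (∀ a → eS a ≡ (a , CyclicPointed._*ᵣ_ B (CyclicPointed.point B) a))
    -- e_S lands in (S ⋉ M)₀
    × (∀ a → InRestricted (eS a))
    -- the image of e_S is exactly the image of σ
    × (∀ q → (∃[ a ] q ≡ eS a → ∃[ p ] q ≡ σ p) × (∃[ p ] q ≡ σ p → ∃[ a ] q ≡ eS a))
    -- e_S is injective
    × (∀ a b → eS a ≡ eS b → a ≡ b)
    -- e_S is an order embedding
    × (∀ a b → (a ≤ b → eS a ⊑ eS b) × (eS a ⊑ eS b → a ≤ b))
    -- e_S preserves products
    × (∀ a b → eS (a · b) ≡ eS a ∘ eS b)
    -- e_S preserves all existing joins, into S ⋉ M and into (S ⋉ M)₀
    × (∀ (A : Pred Carrier p) (j : Carrier) → IsJoin _≤_ A j →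
         IsJoin _⊑_ (eImage A) (eS j)
         × ((r : InRestricted (eS j)) → IsJoin _⊑₀_ (eImage₀ A) (eS j , r)))
mainTheorem7 S M B =
    eS≡⟨a,0*a⟩ , eS-restricted , eS-image⇔σ-image , eS-injective , eS-orderEmbedding
  , eS-homomorphism , λ A j J → eS-preservesJoin J , eS-preservesJoin₀ J
  where open EmbeddingProperties B
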